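{- Let $S_1,\dots,S_8$ be the following $4$-cycle systems of $K_9$ (each cycle $abcd$ listed by its vertices in cyclic order): $S_1$: 1234, 1356, 1527, 1829, 2476, 3648, 3759, 4589, 6879; $S_2$: 1234, 1356, 1527, 1829, 2476, 3687, 3849, 4596, 5798; $S_3$: 1234, 1356, 1527, 1829, 2486, 3647, 3859, 4579, 6789; $S_4$: 1234, 1356, 1527, 1829, 2486, 3647, 3879, 4589, 5769; $S_5$: 1234, 1356, 1527, 1829, 2486, 3678, 3749, 4596, 5798; $S_6$: 1234, 1356, 1527, 1829, 2486, 3678, 3759, 4589, 4697; $S_7$: 1234, 1356, 1527, 1829, 2486, 3698, 3749, 4576, 5879; $S_8$: 1234, 1356, 1527, 1849, 2458, 2689, 3678, 3759, 4697. Then for every $i,j\in\{1,\dots,8\}$ and every permutation $\sigma$ of $\{1,\dots,9\}$ there is a path between $S_i^{\sigma}$ and $S_j^{\sigma}$ in which each edge is a $4$-cycle bitrade of volume $3$.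
   Context: A $4$-cycle $abcd$ has vertices $a,b,c,d$ and edges $\{a,b\},\{b,c\},\{c,d\},\{d,a\}$; cycles are identified with their edge sets. A $4$-cycle system of order $9$ is a collection of $4$-cycles whose edge sets partition the edges of $K_9$ on $\{1,\dots,9\}$. A $4$-cycle bitrade $(T,T')$ of volume $s$ is a pair of disjoint sets of $s$ pairwise edge-disjoint $4$-cycles covering the same edge set. A path between $4$-cycle systems $A$ and $B$ is a sequence $A=C_0,\dots,C_m=B$ of $4$-cycle systems such that each $C_i$ is obtained from $C_{i-1}$ by a bitrade $(T,T')$ with $T\subseteq C_{i-1}$ and $C_i=(C_{i-1}\setminus T)\cup T'$ (these bitrades are the edges of the path). For a set $X$ of $4$-cycles and a permutation $\sigma$ of $\{1,\dots,9\}$, $X^{\sigma}$ is obtained by applying $\sigma$ to every vertex of every cycle of $X$. -}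

module Defs where

open import Data.Nat using (ℕ; zero; suc; _≤_)
open import Data.Fin using (Fin; #_)
open import Data.Fin.Properties using (_≟_)
open import Data.Fin.Permutation using (Permutation′; _⟨$⟩ʳ_)
open import Data.Bool using (Bool; true; false; T; _∧_; _∨_; not; if_then_else_)
open import Relation.Nullary.Decidable using (⌊_⌋)
open import Relation.Nullary using (¬_)
open import Data.List using (List; []; _∷_; map; length)
open import Data.List.Relation.Unary.Any using (Any)
open import Data.List.Relation.Unary.All using (All)
open import Data.Product using (Σ; _×_)
open import Data.Sum using (_⊎_)
open import Relation.Binary.PropositionalEquality using (_≡_; _≢_)

-- Vertex set {1,...,9}; the label k is represented by the element (k-1) of Fin 9.
V : Set
V = Fin 9

_==_ : V → V → Bool
x == y = ⌊ x ≟ y ⌋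

-- A (candidate) 4-cycle abcd, given by its vertices in cyclic order.
record Cyc : Set where
  constructor cyc
  field
    a b c d : V
open Cyc public

Is4Cycle : Cyc → Set
Is4Cycle C = T (not (a C == b C) ∧ not (a C == c C) ∧ not (a C == d C)
              ∧ not (b C == c C) ∧ not (b C == d C) ∧ not (c C == d C))

link : V → V → V → V → Bool
link p q x y = (p == x ∧ q == y) ∨ (p == y ∧ q == x)

hasEdge : Cyc → V → V → Bool
hasEdge C x y = link (a C) (b C) x y ∨ link (b C) (c C) x y
              ∨ link (c C) (d C) x y ∨ link (d C) (a C) x y

-- Cycles are identified with their edge sets.
_≈_ : Cyc → Cyc → Set
C ≈ D = ∀ x y → hasEdge C x y ≡ hasEdge D x y

infix 4 _∈≈_ _≈_
infix 2 _⇔_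
_∈≈_ : Cyc → List Cyc → Set
C ∈≈ L = Any (C ≈_) L

_⇔_ : Set → Set → Set
P ⇔ Q = (P → Q) × (Q → P)

SameSet : List Cyc → List Cyc → Set
SameSet L M = ∀ X → (X ∈≈ L) ⇔ (X ∈≈ M)

count : List Cyc → V → V → ℕ
count [] x y = 0
count (C ∷ L) x y = if hasEdge C x y then suc (count L x y) else count L x y

Covers : List Cyc → V → V → Set
Covers L x y = Any (λ C → T (hasEdge C x y)) L

EdgeDisjoint : List Cyc → Set
EdgeDisjoint L = ∀ x y → count L x y ≤ 1

Is4CycleSystem : List Cyc → Set
Is4CycleSystem S = All Is4Cycle S × (∀ x y → x ≢ y → count S x y ≡ 1)

IsBitrade : ℕ → List Cyc → List Cyc → Set
IsBitrade s T₁ T₂ =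
  All Is4Cycle T₁ × All Is4Cycle T₂ ×
  EdgeDisjoint T₁ × EdgeDisjoint T₂ ×
  length T₁ ≡ s × length T₂ ≡ s ×
  (∀ X → X ∈≈ T₁ → ¬ (X ∈≈ T₂)) ×
  (∀ x y → Covers T₁ x y ⇔ Covers T₂ x y)

Step : ℕ → List Cyc → List Cyc → Set
Step s C C' = Σ (List Cyc) λ T₁ → Σ (List Cyc) λ T₂ →
  IsBitrade s T₁ T₂ ×
  (∀ X → X ∈≈ T₁ → X ∈≈ C) ×
  (∀ X → X ∈≈ C' ⇔ ((X ∈≈ C × ¬ (X ∈≈ T₁)) ⊎ X ∈≈ T₂))

data Path (s : ℕ) : List Cyc → List Cyc → Set where
  done : ∀ {A B} → Is4CycleSystem A → SameSet A B → Path s A B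
  step : ∀ {A C B} → Is4CycleSystem A → Step s A C → Path s C B → Path s A B

applyCyc : Permutation′ 9 → Cyc → Cyc
applyCyc σ (cyc p q r t) = cyc (σ ⟨$⟩ʳ p) (σ ⟨$⟩ʳ q) (σ ⟨$⟩ʳ r) (σ ⟨$⟩ʳ t)

_^_ : List Cyc → Permutation′ 9 → List Cyc
X ^ σ = map (applyCyc σ) X

-- the systems S₁,…,S₈ (S i is S_{i+1}); vertex label k ↦ # (k-1)
cy : ℕ → ℕ → ℕ → ℕ → Cyc
cy p q r t = cyc (l p) (l q) (l r) (l t)
  where
  l : ℕ → V
  l 1 = # 0
  l 2 = # 1
  l 3 = # 2
  l 4 = # 3
  l 5 = # 4
  l 6 = # 5
  l 7 = # 6
  l 8 = # 7
  l 9 = # 8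
  l _ = # 0   -- never used

S : Fin 8 → List Cyc
S Fin.zero = cy 1 2 3 4 ∷ cy 1 3 5 6 ∷ cy 1 5 2 7 ∷ cy 1 8 2 9 ∷ cy 2 4 7 6 ∷ cy 3 6 4 8 ∷ cy 3 7 5 9 ∷ cy 4 5 8 9 ∷ cy 6 8 7 9 ∷ []
S (Fin.suc Fin.zero) = cy 1 2 3 4 ∷ cy 1 3 5 6 ∷ cy 1 5 2 7 ∷ cy 1 8 2 9 ∷ cy 2 4 7 6 ∷ cy 3 6 8 7 ∷ cy 3 8 4 9 ∷ cy 4 5 9 6 ∷ cy 5 7 9 8 ∷ []
S (Fin.suc (Fin.suc Fin.zero)) = cy 1 2 3 4 ∷ cy 1 3 5 6 ∷ cy 1 5 2 7 ∷ cy 1 8 2 9 ∷ cy 2 4 8 6 ∷ cy 3 6 4 7 ∷ cy 3 8 5 9 ∷ cy 4 5 7 9 ∷ cy 6 7 8 9 ∷ []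
S (Fin.suc (Fin.suc (Fin.suc Fin.zero))) = cy 1 2 3 4 ∷ cy 1 3 5 6 ∷ cy 1 5 2 7 ∷ cy 1 8 2 9 ∷ cy 2 4 8 6 ∷ cy 3 6 4 7 ∷ cy 3 8 7 9 ∷ cy 4 5 8 9 ∷ cy 5 7 6 9 ∷ []
S (Fin.suc (Fin.suc (Fin.suc (Fin.suc Fin.zero)))) = cy 1 2 3 4 ∷ cy 1 3 5 6 ∷ cy 1 5 2 7 ∷ cy 1 8 2 9 ∷ cy 2 4 8 6 ∷ cy 3 6 7 8 ∷ cy 3 7 4 9 ∷ cy 4 5 9 6 ∷ cy 5 7 9 8 ∷ []
S (Fin.suc (Fin.suc (Fin.suc (Fin.suc (Fin.suc Fin.zero))))) = cy 1 2 3 4 ∷ cy 1 3 5 6 ∷ cy 1 5 2 7 ∷ cy 1 8 2 9 ∷ cy 2 4 8 6 ∷ cy 3 6 7 8 ∷ cy 3 7 5 9 ∷ cy 4 5 8 9 ∷ cy 4 6 9 7 ∷ []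
S (Fin.suc (Fin.suc (Fin.suc (Fin.suc (Fin.suc (Fin.suc Fin.zero)))))) = cy 1 2 3 4 ∷ cy 1 3 5 6 ∷ cy 1 5 2 7 ∷ cy 1 8 2 9 ∷ cy 2 4 8 6 ∷ cy 3 6 9 8 ∷ cy 3 7 4 9 ∷ cy 4 5 7 6 ∷ cy 5 8 7 9 ∷ []
S (Fin.suc (Fin.suc (Fin.suc (Fin.suc (Fin.suc (Fin.suc (Fin.suc Fin.zero))))))) = cy 1 2 3 4 ∷ cy 1 3 5 6 ∷ cy 1 5 2 7 ∷ cy 1 8 4 9 ∷ cy 2 4 5 8 ∷ cy 2 6 8 9 ∷ cy 3 6 7 8 ∷ cy 3 7 5 9 ∷ cy 4 6 9 7 ∷ []

-- Being a 4-cycle system, a bitrade or a path depends only on edge incidences, which a vertex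
-- permutation σ preserves: hasEdge (C^σ) (σ x) (σ y) = hasEdge C x y. So it suffices to connect the
-- Sᵢ themselves. Ten volume-3 bitrades, among the Sᵢ and three auxiliary systems and each checked in
-- both directions by evaluation, join every Sᵢ to S₆, giving paths Sᵢ → S₆ → Sⱼ.

module Submission where

open import Defs
open import Data.Fin using (Fin)
open import Data.Fin.Permutation using (Permutation′; _⟨$⟩ʳ_; _⟨$⟩ˡ_; flip; inverseʳ)

open import Data.Bool using (T)
import Data.Bool.Properties as Bool
open import Data.Fin.Patterns using (0F; 1F; 2F; 3F; 4F; 5F; 6F; 7F)
import Data.Fin.Properties as Fin
open import Data.List using (List; []; _∷_; length)
open import Data.List.Properties using (length-map)
open import Data.List.Relation.Unary.All as All using (All; all?)
import Data.List.Relation.Unary.All.Properties as Allₚ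
open import Data.List.Relation.Unary.Any as Any using (any?)
import Data.List.Relation.Unary.Any.Properties as Anyₚ
open import Data.Nat using (ℕ; _≤_; _≤?_)
import Data.Nat as ℕ
open import Data.Product using (_×_; _,_; proj₁; proj₂)
import Data.Product as Product
open import Data.Sum using (_⊎_; inj₁; inj₂)
import Data.Sum as Sum
open import Function using (_∘_; id)
open import Function.Bundles using (mk⇔; Injection)
open import Function.Properties.Inverse using (↔⇒↣)
open import Relation.Binary.Bundles using (Setoid)
open import Relation.Binary.Construct.Closure.ReflexiveTransitive using (Star; ε; _◅_; _◅◅_; reverse)
open import Relation.Binary.PropositionalEquality using (_≡_; refl; sym; trans; cong; cong₂; subst; module ≡-Reasoning)
open import Relation.Nullary using (Dec; does; ¬_; ¬?)
open import Relation.Nullary.Decidable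
  using (_×-dec_; _⊎-dec_; _→-dec_; map′; T?; True; toWitness; does-⇔; isYes≗does; ⌊_⌋)

≈-refl : ∀ {C} → C ≈ C
≈-refl _ _ = refl

≈-sym : ∀ {C D} → C ≈ D → D ≈ C
≈-sym C≈D x y = sym (C≈D x y)

≈-trans : ∀ {C D E} → C ≈ D → D ≈ E → C ≈ E
≈-trans C≈D D≈E x y = trans (C≈D x y) (D≈E x y)

≈-setoid : Setoid _ _
≈-setoid = record
  { Carrier       = Cyc
  ; _≈_           = _≈_
  ; isEquivalence = record
    { refl  = λ {C} → ≈-refl {C}
    ; sym   = λ {C D} → ≈-sym {C} {D}
    ; trans = λ {C D E} → ≈-trans {C} {D} {E}
    }
  }

⇔-trans : ∀ {P Q R : Set} → P ⇔ Q → Q ⇔ R → P ⇔ R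
⇔-trans (f , f⁻¹) (g , g⁻¹) = g ∘ f , f⁻¹ ∘ g⁻¹

⇔-sym : ∀ {P Q : Set} → P ⇔ Q → Q ⇔ P
⇔-sym (f , f⁻¹) = f⁻¹ , f

-- Unlike _Respects_, the cycles are explicit: C ≈ D unfolds to a Π-type from which C and D cannot be inferred.
Respects≈ : (Cyc → Set) → Set
Respects≈ P = ∀ X Y → X ≈ Y → P X → P Y

∈≈-resp : ∀ L → Respects≈ (_∈≈ L)
∈≈-resp L X Y X≈Y = Any.map λ {Z} → ≈-trans {Y} {X} {Z} (≈-sym {X} {Y} X≈Y)

∉≈-resp : ∀ L → Respects≈ (λ X → ¬ X ∈≈ L)
∉≈-resp L X Y X≈Y X∉L Y∈L = X∉L (∈≈-resp L Y X (≈-sym {X} {Y} X≈Y) Y∈L)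

_⊆≈_ : List Cyc → List Cyc → Set
L ⊆≈ M = ∀ X → X ∈≈ L → X ∈≈ M

Replaces : List Cyc → List Cyc → List Cyc → List Cyc → Set
Replaces C C' T₁ T₂ = ∀ X → X ∈≈ C' ⇔ ((X ∈≈ C × ¬ (X ∈≈ T₁)) ⊎ X ∈≈ T₂)

StepVia : ℕ → List Cyc → List Cyc → List Cyc → List Cyc → Set
StepVia s C C' T₁ T₂ = IsBitrade s T₁ T₂ × T₁ ⊆≈ C × Replaces C C' T₁ T₂

_≈?_ : ∀ C D → Dec (C ≈ D)
C ≈? D = Fin.all? λ x → Fin.all? λ y → hasEdge C x y Bool.≟ hasEdge D x y

_∈≈?_ : ∀ X L → Dec (X ∈≈ L)
X ∈≈? L = any? (X ≈?_) L

∀∈≈? : ∀ {P : Cyc → Set} → Respects≈ P → (∀ X → Dec (P X)) → ∀ L → Dec (∀ X → X ∈≈ L → P X)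
∀∈≈? resp P? L = map′ (λ ps X → All.lookupₛ ≈-setoid (λ {X} {Y} → resp X Y) ps {X})
                      (λ h → All.tabulateₛ ≈-setoid λ {X} → h X)
                      (all? P? L)

_⇔?_ : ∀ {P Q : Set} → Dec P → Dec Q → Dec (P ⇔ Q)
p ⇔? q = (p →-dec q) ×-dec (q →-dec p)

is4Cycle? : ∀ C → Dec (Is4Cycle C)
is4Cycle? C = T? _

covers? : ∀ L x y → Dec (Covers L x y)
covers? L x y = any? (λ C → T? (hasEdge C x y)) L

edgeDisjoint? : ∀ L → Dec (EdgeDisjoint L)
edgeDisjoint? L = Fin.all? λ x → Fin.all? λ y → count L x y ≤? 1

is4CycleSystem? : ∀ A → Dec (Is4CycleSystem A)
is4CycleSystem? A =
  all? is4Cycle? A ×-dec Fin.all? λ x → Fin.all? λ y → ¬? (x Fin.≟ y) →-dec count A x y ℕ.≟ 1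

isBitrade? : ∀ s T₁ T₂ → Dec (IsBitrade s T₁ T₂)
isBitrade? s T₁ T₂ =
  all? is4Cycle? T₁ ×-dec all? is4Cycle? T₂ ×-dec
  edgeDisjoint? T₁ ×-dec edgeDisjoint? T₂ ×-dec
  length T₁ ℕ.≟ s ×-dec length T₂ ℕ.≟ s ×-dec
  ∀∈≈? {P = λ X → ¬ X ∈≈ T₂} (∉≈-resp T₂) (λ X → ¬? (X ∈≈? T₂)) T₁ ×-dec
  (Fin.all? λ x → Fin.all? λ y → covers? T₁ x y ⇔? covers? T₂ x y)

⊆≈? : ∀ L M → Dec (L ⊆≈ M)
⊆≈? L M = ∀∈≈? {P = _∈≈ M} (∈≈-resp M) (_∈≈? M) L

replaces? : ∀ C C' T₁ T₂ → Dec (Replaces C C' T₁ T₂)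
replaces? C C' T₁ T₂ = map′ combine split (removed? ×-dec kept? ×-dec ⊆≈? T₂ C')
  where
  Result : Cyc → Set
  Result X = (X ∈≈ C × ¬ (X ∈≈ T₁)) ⊎ X ∈≈ T₂

  Kept : Cyc → Set
  Kept X = ¬ X ∈≈ T₁ → X ∈≈ C'

  Parts : Set
  Parts = (∀ X → X ∈≈ C' → Result X) × (∀ X → X ∈≈ C → Kept X) × T₂ ⊆≈ C'

  combine : Parts → Replaces C C' T₁ T₂
  combine (sound , kept , new) X = sound X , Sum.[ (λ (X∈C , X∉T₁) → kept X X∈C X∉T₁) , new X ]

  split : Replaces C C' T₁ T₂ → Parts
  split h = (λ X → proj₁ (h X)) , (λ X X∈C X∉T₁ → proj₂ (h X) (inj₁ (X∈C , X∉T₁))) , (λ X → proj₂ (h X) ∘ inj₂)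

  result-resp : Respects≈ Result
  result-resp X Y X≈Y =
    Sum.map (Product.map (∈≈-resp C X Y X≈Y) (∉≈-resp T₁ X Y X≈Y)) (∈≈-resp T₂ X Y X≈Y)

  kept-resp : Respects≈ Kept
  kept-resp X Y X≈Y h = ∈≈-resp C' X Y X≈Y ∘ h ∘ ∉≈-resp T₁ Y X (≈-sym {X} {Y} X≈Y)

  removed? : Dec (∀ X → X ∈≈ C' → Result X)
  removed? = ∀∈≈? result-resp (λ X → ((X ∈≈? C) ×-dec ¬? (X ∈≈? T₁)) ⊎-dec (X ∈≈? T₂)) C'

  kept? : Dec (∀ X → X ∈≈ C → Kept X)
  kept? = ∀∈≈? kept-resp (λ X → ¬? (X ∈≈? T₁) →-dec (X ∈≈? C')) C

stepVia? : ∀ s C C' T₁ T₂ → Dec (StepVia s C C' T₁ T₂)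
stepVia? s C C' T₁ T₂ = isBitrade? s T₁ T₂ ×-dec ⊆≈? T₁ C ×-dec replaces? C C' T₁ T₂

module _ (σ : Permutation′ 9) where

  ==-image : ∀ x y → ((σ ⟨$⟩ʳ x) == (σ ⟨$⟩ʳ y)) ≡ (x == y)
  ==-image x y = begin
    ⌊ σx≟σy ⌋        ≡⟨ isYes≗does σx≟σy ⟩
    does σx≟σy       ≡⟨ does-⇔ (mk⇔ (Injection.injective (↔⇒↣ σ)) (cong (σ ⟨$⟩ʳ_))) σx≟σy (x Fin.≟ y) ⟩
    does (x Fin.≟ y) ≡⟨ isYes≗does (x Fin.≟ y) ⟨
    ⌊ x Fin.≟ y ⌋    ∎
    where
    open ≡-Reasoning
    σx≟σy : Dec ((σ ⟨$⟩ʳ x) ≡ (σ ⟨$⟩ʳ y))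
    σx≟σy = (σ ⟨$⟩ʳ x) Fin.≟ (σ ⟨$⟩ʳ y)

  link-image : ∀ p q x y → link (σ ⟨$⟩ʳ p) (σ ⟨$⟩ʳ q) (σ ⟨$⟩ʳ x) (σ ⟨$⟩ʳ y) ≡ link p q x y
  link-image p q x y rewrite ==-image p x | ==-image q y | ==-image p y | ==-image q x = refl

  hasEdge-image : ∀ C x y → hasEdge (applyCyc σ C) (σ ⟨$⟩ʳ x) (σ ⟨$⟩ʳ y) ≡ hasEdge C x y
  hasEdge-image (cyc p q r t) x y
    rewrite link-image p q x y | link-image q r x y | link-image r t x y | link-image t p x y = refl

  hasEdge-applyCyc : ∀ C x y → hasEdge (applyCyc σ C) x y ≡ hasEdge C (σ ⟨$⟩ˡ x) (σ ⟨$⟩ˡ y)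
  hasEdge-applyCyc C x y = begin
    hasEdge (applyCyc σ C) x y                                      ≡⟨ cong₂ (hasEdge (applyCyc σ C)) (inverseʳ σ) (inverseʳ σ) ⟨
    hasEdge (applyCyc σ C) (σ ⟨$⟩ʳ (σ ⟨$⟩ˡ x)) (σ ⟨$⟩ʳ (σ ⟨$⟩ˡ y)) ≡⟨ hasEdge-image C _ _ ⟩
    hasEdge C (σ ⟨$⟩ˡ x) (σ ⟨$⟩ˡ y)                                 ∎
    where open ≡-Reasoning

  Is4Cycle-applyCyc : ∀ C → Is4Cycle C → Is4Cycle (applyCyc σ C)
  Is4Cycle-applyCyc (cyc p q r t)
    rewrite ==-image p q | ==-image p r | ==-image p t | ==-image q r | ==-image q t | ==-image r t = id

module _ (σ : Permutation′ 9) where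

  ≈-applyCyc : ∀ X C → X ≈ applyCyc σ C ⇔ applyCyc (flip σ) X ≈ C
  ≈-applyCyc X C = to , from
    where
    open ≡-Reasoning
    to : X ≈ applyCyc σ C → applyCyc (flip σ) X ≈ C
    to X≈σC u v = begin
      hasEdge (applyCyc (flip σ) X) u v            ≡⟨ hasEdge-applyCyc (flip σ) X u v ⟩
      hasEdge X (σ ⟨$⟩ʳ u) (σ ⟨$⟩ʳ v)              ≡⟨ X≈σC _ _ ⟩
      hasEdge (applyCyc σ C) (σ ⟨$⟩ʳ u) (σ ⟨$⟩ʳ v) ≡⟨ hasEdge-image σ C u v ⟩
      hasEdge C u v                                ∎
    from : applyCyc (flip σ) X ≈ C → X ≈ applyCyc σ C
    from σ⁻¹X≈C x y = begin
      hasEdge X x y                                       ≡⟨ hasEdge-image (flip σ) X x y ⟨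
      hasEdge (applyCyc (flip σ) X) (σ ⟨$⟩ˡ x) (σ ⟨$⟩ˡ y) ≡⟨ σ⁻¹X≈C _ _ ⟩
      hasEdge C (σ ⟨$⟩ˡ x) (σ ⟨$⟩ˡ y)                     ≡⟨ hasEdge-applyCyc σ C x y ⟨
      hasEdge (applyCyc σ C) x y                          ∎

  ∈≈-^ : ∀ L X → X ∈≈ L ^ σ ⇔ applyCyc (flip σ) X ∈≈ L
  ∈≈-^ L X =
    Any.map (λ {C} → proj₁ (≈-applyCyc X C)) ∘ Anyₚ.map⁻ ,
    Anyₚ.map⁺ ∘ Any.map (λ {C} → proj₂ (≈-applyCyc X C))

  count-^ : ∀ L x y → count (L ^ σ) x y ≡ count L (σ ⟨$⟩ˡ x) (σ ⟨$⟩ˡ y)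
  count-^ []      x y = refl
  count-^ (C ∷ L) x y rewrite hasEdge-applyCyc σ C x y | count-^ L x y = refl

  Covers-^ : ∀ L x y → Covers (L ^ σ) x y ⇔ Covers L (σ ⟨$⟩ˡ x) (σ ⟨$⟩ˡ y)
  Covers-^ L x y =
    Any.map (λ {C} → subst T (hasEdge-applyCyc σ C x y)) ∘ Anyₚ.map⁻ ,
    Anyₚ.map⁺ ∘ Any.map (λ {C} → subst T (sym (hasEdge-applyCyc σ C x y)))

  All-Is4Cycle-^ : ∀ {L} → All Is4Cycle L → All Is4Cycle (L ^ σ)
  All-Is4Cycle-^ = Allₚ.map⁺ ∘ All.map (Is4Cycle-applyCyc σ _)

  EdgeDisjoint-^ : ∀ L → EdgeDisjoint L → EdgeDisjoint (L ^ σ)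
  EdgeDisjoint-^ L disjoint x y = subst (_≤ 1) (sym (count-^ L x y)) (disjoint _ _)

  Is4CycleSystem-^ : ∀ A → Is4CycleSystem A → Is4CycleSystem (A ^ σ)
  Is4CycleSystem-^ A (cycles , once) =
    All-Is4Cycle-^ cycles ,
    λ x y x≢y → trans (count-^ A x y) (once _ _ (x≢y ∘ Injection.injective (↔⇒↣ (flip σ))))

  IsBitrade-^ : ∀ s T₁ T₂ → IsBitrade s T₁ T₂ → IsBitrade s (T₁ ^ σ) (T₂ ^ σ)
  IsBitrade-^ s T₁ T₂ (cycles₁ , cycles₂ , disjoint₁ , disjoint₂ , size₁ , size₂ , distinct , sameEdges) =
    All-Is4Cycle-^ cycles₁ , All-Is4Cycle-^ cycles₂ ,
    EdgeDisjoint-^ T₁ disjoint₁ , EdgeDisjoint-^ T₂ disjoint₂ ,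
    trans (length-map _ T₁) size₁ , trans (length-map _ T₂) size₂ ,
    (λ X X∈T₁ X∈T₂ → distinct (applyCyc (flip σ) X) (proj₁ (∈≈-^ T₁ X) X∈T₁) (proj₁ (∈≈-^ T₂ X) X∈T₂)) ,
    λ x y → ⇔-trans (Covers-^ T₁ x y) (⇔-trans (sameEdges (σ ⟨$⟩ˡ x) (σ ⟨$⟩ˡ y)) (⇔-sym (Covers-^ T₂ x y)))

  ⊆≈-^ : ∀ L M → L ⊆≈ M → (L ^ σ) ⊆≈ (M ^ σ)
  ⊆≈-^ L M L⊆M X = proj₂ (∈≈-^ M X) ∘ L⊆M (applyCyc (flip σ) X) ∘ proj₁ (∈≈-^ L X)

  Replaces-^ : ∀ C C' T₁ T₂ → Replaces C C' T₁ T₂ → Replaces (C ^ σ) (C' ^ σ) (T₁ ^ σ) (T₂ ^ σ)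
  Replaces-^ C C' T₁ T₂ replaces X = ⇔-trans (∈≈-^ C' X) (⇔-trans (replaces σ⁻¹X) (to , from))
    where
    σ⁻¹X : Cyc
    σ⁻¹X = applyCyc (flip σ) X
    to : (σ⁻¹X ∈≈ C × ¬ σ⁻¹X ∈≈ T₁) ⊎ σ⁻¹X ∈≈ T₂ → (X ∈≈ C ^ σ × ¬ X ∈≈ T₁ ^ σ) ⊎ X ∈≈ T₂ ^ σ
    to = Sum.map (Product.map (proj₂ (∈≈-^ C X)) (_∘ proj₁ (∈≈-^ T₁ X))) (proj₂ (∈≈-^ T₂ X))
    from : (X ∈≈ C ^ σ × ¬ X ∈≈ T₁ ^ σ) ⊎ X ∈≈ T₂ ^ σ → (σ⁻¹X ∈≈ C × ¬ σ⁻¹X ∈≈ T₁) ⊎ σ⁻¹X ∈≈ T₂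
    from = Sum.map (Product.map (proj₁ (∈≈-^ C X)) (_∘ proj₂ (∈≈-^ T₁ X))) (proj₁ (∈≈-^ T₂ X))

  Step-^ : ∀ s C C' → Step s C C' → Step s (C ^ σ) (C' ^ σ)
  Step-^ s C C' (T₁ , T₂ , bitrade , T₁⊆C , replaces) =
    T₁ ^ σ , T₂ ^ σ , IsBitrade-^ s T₁ T₂ bitrade , ⊆≈-^ T₁ C T₁⊆C , Replaces-^ C C' T₁ T₂ replaces

  SameSet-^ : ∀ A B → SameSet A B → SameSet (A ^ σ) (B ^ σ)
  SameSet-^ A B same X = ⇔-trans (∈≈-^ A X) (⇔-trans (same (applyCyc (flip σ) X)) (⇔-sym (∈≈-^ B X)))

  Path-^ : ∀ {s A B} → Path s A B → Path s (A ^ σ) (B ^ σ)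
  Path-^ {A = A} {B} (done system same)       = done (Is4CycleSystem-^ A system) (SameSet-^ A B same)
  Path-^ {s} {A} (step {C = C} system st path) = step (Is4CycleSystem-^ A system) (Step-^ s A C st) (Path-^ path)

record Adjacent (s : ℕ) (A B : List Cyc) : Set where
  field
    sourceSystem : Is4CycleSystem A
    targetSystem : Is4CycleSystem B
    forward      : Step s A B
    backward     : Step s B A

Adjacent-sym : ∀ {s A B} → Adjacent s A B → Adjacent s B A
Adjacent-sym record { sourceSystem = sA ; targetSystem = sB ; forward = f ; backward = b } =
  record { sourceSystem = sB ; targetSystem = sA ; forward = b ; backward = f }

Star⇒Path : ∀ {s A B} → Is4CycleSystem A → Star (Adjacent s) A B → Path s A B
Star⇒Path system ε                 = done system (λ X → id , id)
Star⇒Path system (adjacent ◅ path) =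
  step system (Adjacent.forward adjacent) (Star⇒Path (Adjacent.targetSystem adjacent) path)

adjacentBy : ∀ A B T₁ T₂ →
  {True (is4CycleSystem? A ×-dec is4CycleSystem? B ×-dec stepVia? 3 A B T₁ T₂ ×-dec stepVia? 3 B A T₂ T₁)} →
  Adjacent 3 A B
adjacentBy A B T₁ T₂ {checked} =
  let sA , sB , forward , backward = toWitness checked
  in record { sourceSystem = sA ; targetSystem = sB ; forward = T₁ , T₂ , forward ; backward = T₂ , T₁ , backward }

-- Auxiliary 4-cycle systems, through which S₃ and S₇ are reached from S₁.
M₁ M₂ M₃ : List Cyc
M₁ = cy 6 7 9 8 ∷ cy 1 5 2 7 ∷ cy 3 7 5 9 ∷ cy 1 3 5 6 ∷ cy 3 6 4 8 ∷ cy 1 2 3 4 ∷ cy 4 5 8 7 ∷ cy 1 8 2 9 ∷ cy 2 4 9 6 ∷ []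
M₂ = cy 6 7 9 8 ∷ cy 3 6 4 7 ∷ cy 1 5 2 7 ∷ cy 4 5 7 8 ∷ cy 1 3 5 6 ∷ cy 1 2 3 4 ∷ cy 3 8 5 9 ∷ cy 1 8 2 9 ∷ cy 2 4 9 6 ∷ []
M₃ = cy 3 6 9 8 ∷ cy 1 5 2 7 ∷ cy 2 4 8 6 ∷ cy 3 7 5 9 ∷ cy 1 3 5 6 ∷ cy 4 6 7 9 ∷ cy 1 2 3 4 ∷ cy 4 5 8 7 ∷ cy 1 8 2 9 ∷ []

S₁-S₆ : Adjacent 3 (S 0F) (S 5F)
S₁-S₆ = adjacentBy _ _ (cy 2 4 7 6 ∷ cy 6 8 7 9 ∷ cy 3 6 4 8 ∷ []) (cy 3 6 7 8 ∷ cy 2 4 8 6 ∷ cy 4 6 9 7 ∷ [])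

S₂-S₅ : Adjacent 3 (S 1F) (S 4F)
S₂-S₅ = adjacentBy _ _ (cy 2 4 7 6 ∷ cy 3 6 8 7 ∷ cy 3 8 4 9 ∷ []) (cy 3 6 7 8 ∷ cy 2 4 8 6 ∷ cy 3 7 4 9 ∷ [])

S₃-M₂ : Adjacent 3 (S 2F) M₂
S₃-M₂ = adjacentBy _ _ (cy 2 4 8 6 ∷ cy 6 7 8 9 ∷ cy 4 5 7 9 ∷ []) (cy 6 7 9 8 ∷ cy 4 5 7 8 ∷ cy 2 4 9 6 ∷ [])

S₄-S₆ : Adjacent 3 (S 3F) (S 5F)
S₄-S₆ = adjacentBy _ _ (cy 3 8 7 9 ∷ cy 3 6 4 7 ∷ cy 5 7 6 9 ∷ []) (cy 3 6 7 8 ∷ cy 4 6 9 7 ∷ cy 3 7 5 9 ∷ [])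

S₅-S₆ : Adjacent 3 (S 4F) (S 5F)
S₅-S₆ = adjacentBy _ _ (cy 3 7 4 9 ∷ cy 5 7 9 8 ∷ cy 4 5 9 6 ∷ []) (cy 4 5 8 9 ∷ cy 4 6 9 7 ∷ cy 3 7 5 9 ∷ [])

S₇-M₃ : Adjacent 3 (S 6F) M₃
S₇-M₃ = adjacentBy _ _ (cy 3 7 4 9 ∷ cy 5 8 7 9 ∷ cy 4 5 7 6 ∷ []) (cy 4 6 7 9 ∷ cy 4 5 8 7 ∷ cy 3 7 5 9 ∷ [])

S₈-S₆ : Adjacent 3 (S 7F) (S 5F)
S₈-S₆ = adjacentBy _ _ (cy 2 6 8 9 ∷ cy 1 8 4 9 ∷ cy 2 4 5 8 ∷ []) (cy 2 4 8 6 ∷ cy 4 5 8 9 ∷ cy 1 8 2 9 ∷ [])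

M₁-S₁ : Adjacent 3 M₁ (S 0F)
M₁-S₁ = adjacentBy _ _ (cy 6 7 9 8 ∷ cy 4 5 8 7 ∷ cy 2 4 9 6 ∷ []) (cy 2 4 7 6 ∷ cy 6 8 7 9 ∷ cy 4 5 8 9 ∷ [])

M₂-M₁ : Adjacent 3 M₂ M₁
M₂-M₁ = adjacentBy _ _ (cy 3 8 5 9 ∷ cy 4 5 7 8 ∷ cy 3 6 4 7 ∷ []) (cy 4 5 8 7 ∷ cy 3 7 5 9 ∷ cy 3 6 4 8 ∷ [])

M₃-M₁ : Adjacent 3 M₃ M₁
M₃-M₁ = adjacentBy _ _ (cy 3 6 9 8 ∷ cy 2 4 8 6 ∷ cy 4 6 7 9 ∷ []) (cy 6 7 9 8 ∷ cy 3 6 4 8 ∷ cy 2 4 9 6 ∷ [])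

toS₆ : ∀ i → Star (Adjacent 3) (S i) (S 5F)
toS₆ 0F = S₁-S₆ ◅ ε
toS₆ 1F = S₂-S₅ ◅ S₅-S₆ ◅ ε
toS₆ 2F = S₃-M₂ ◅ M₂-M₁ ◅ M₁-S₁ ◅ S₁-S₆ ◅ ε
toS₆ 3F = S₄-S₆ ◅ ε
toS₆ 4F = S₅-S₆ ◅ ε
toS₆ 5F = ε
toS₆ 6F = S₇-M₃ ◅ M₃-M₁ ◅ M₁-S₁ ◅ S₁-S₆ ◅ ε
toS₆ 7F = S₈-S₆ ◅ ε

S-connected : ∀ i j → Star (Adjacent 3) (S i) (S j)
S-connected i j = toS₆ i ◅◅ reverse Adjacent-sym (toS₆ j)

S-is4CycleSystem : ∀ i → Is4CycleSystem (S i)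
S-is4CycleSystem = toWitness {a? = Fin.all? (is4CycleSystem? ∘ S)} _

mainTheorem9 : (i j : Fin 8) (σ : Permutation′ 9) → Path 3 (S i ^ σ) (S j ^ σ)
mainTheorem9 i j σ = Path-^ σ (Star⇒Path (S-is4CycleSystem i) (S-connected i j))
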